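{- Let $\mathcal L$ be a finite, bounded, atomic and graded lattice and let $\mathcal P$ be a geometric lattice with $\mathrm{rank}(\mathcal P)=\mathrm{rank}(\mathcal L)$. Let $f':A(\mathcal L)\to A(\mathcal P)$ be a bijection. Then $f'$ can be extended to a rank-preserving order embedding $f:\mathcal L\to\mathcal P$ if and only if both of the following hold: (i) $f'(I)\in I(\mathcal P)$ for every $I\in I(\mathcal L)$; (ii) $f'(A)\notin I(\mathcal P)$ for every set of atoms $A\subseteq A(\mathcal L)$ with $|A|>\mathrm{rank}\left(\bigvee A\right)$.
   Context: All lattices are finite. A lattice is bounded if it has a least element $\hat 0$ and a greatest element $\hat 1$. It is graded if it is bounded and has a rank function $\mathrm{rank}$ with $\mathrm{rank}(\hat 0)=0$, order-preserving, and with $\mathrm{rank}(Y)=\mathrm{rank}(X)+1$ whenever $Y$ covers $X$; the rank of the lattice is $\mathrm{rank}(\hat 1)$. An atom is an element covering $\hat 0$; $A(\mathcal L)$ denotes the set of atoms. The lattice is atomic if every element is a join of atoms. For a linear order $\omega$ on $A(\mathcal L)$, a nonempty set $D\subseteq A(\mathcal L)$ is called bounded below (BB) if there is an atom $a$ which is strictly smaller than every $d\in D$ in the order $\omega$ and satisfies $a\le \bigvee D$ in $\mathcal L$. A set of atoms is NBB with respect to $\omega$ if it contains no BB subset. $I(\mathcal L)$ denotes the family of all subsets of $A(\mathcal L)$ that are NBB with respect to at least one linear order on $A(\mathcal L)$. For a geometric lattice $\mathcal P$ (the lattice of flats of a simple matroid), $I(\mathcal P)$ is defined in the same way. A rank-preserving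 order embedding $f:\mathcal L\to\mathcal P$ is a map with $x\le y\iff f(x)\le f(y)$ and $\mathrm{rank}(f(x))=\mathrm{rank}(x)$ for all $x,y$. For a set $S$ of atoms, $f'(S)=\{f'(s):s\in S\}$. -}

module Defs where

open import Level using (0ℓ)
open import Data.Bool using (Bool; true; false; if_then_else_)
open import Data.Nat as ℕ using (ℕ; zero; suc)
open import Data.Fin using (Fin; zero; suc)
open import Data.Fin.Subset as Sub using (Subset; _∈_; _⊆_; Nonempty; ⁅_⁆; _∪_; ∣_∣)
open import Data.Vec using ([]; _∷_)
open import Data.Product using (Σ; _×_; ∃; _,_)
open import Data.Sum using (_⊎_)
open import Relation.Nullary using (¬_; Dec)
open import Relation.Binary.PropositionalEquality using (_≡_; _≢_)
import Relation.Binary.Lattice.Structures as LS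
open import Function using (_∘_; id)

-- Finite bounded lattices, presented on the carrier Fin size
-- (every finite lattice is isomorphic to one of this form).

record FinLattice : Set₁ where
  field
    size  : ℕ
    _≤_   : Fin size → Fin size → Set
    _≤?_  : ∀ x y → Dec (x ≤ y)
    _∨_   : Fin size → Fin size → Fin size
    _∧_   : Fin size → Fin size → Fin size
    top   : Fin size
    bot   : Fin size
    isBoundedLattice : LS.IsBoundedLattice _≡_ _≤_ _∨_ _∧_ top bot

  Elt : Set
  Elt = Fin size

  _<_ : Elt → Elt → Set
  x < y = (x ≤ y) × (x ≢ y)

  _⋖_ : Elt → Elt → Set
  x ⋖ y = (x < y) × (¬ (Σ Elt λ z → (x < z) × (z < y)))

  IsAtom : Elt → Set
  IsAtom a = bot ⋖ a

  AtomSet : Subset size → Set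
  AtomSet S = ∀ {x} → x ∈ S → IsAtom x

  joinAux : ∀ {m} → (Fin m → Elt) → Subset m → Elt
  joinAux g [] = bot
  joinAux g (b ∷ S) = if b then g zero ∨ joinAux (g ∘ suc) S else joinAux (g ∘ suc) S

  ⋁ : Subset size → Elt
  ⋁ = joinAux id

  IsAtomic : Set
  IsAtomic = ∀ x → Σ (Subset size) λ S → AtomSet S × (⋁ S ≡ x)

  record LinearOrderOnAtoms : Set₁ where
    field
      _≺_     : Elt → Elt → Set
      irrefl  : ∀ {a} → IsAtom a → ¬ (a ≺ a)
      trans   : ∀ {a b c} → IsAtom a → IsAtom b → IsAtom c → a ≺ b → b ≺ c → a ≺ c
      total   : ∀ {a b} → IsAtom a → IsAtom b → a ≢ b → (a ≺ b) ⊎ (b ≺ a)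

  BB : LinearOrderOnAtoms → Subset size → Set
  BB ω D = Nonempty D × AtomSet D ×
           (Σ Elt λ a → IsAtom a × (∀ {d} → d ∈ D → a ≺ d) × (a ≤ ⋁ D))
    where open LinearOrderOnAtoms ω

  NBB : LinearOrderOnAtoms → Subset size → Set
  NBB ω S = AtomSet S × (∀ D → D ⊆ S → ¬ BB ω D)

  InI : Subset size → Set₁
  InI S = Σ LinearOrderOnAtoms λ ω → NBB ω S


record IsGraded (L : FinLattice) : Set where
  open FinLattice L
  field
    rank      : Elt → ℕ
    rank-bot  : rank bot ≡ 0
    rank-mono : ∀ {x y} → x ≤ y → rank x ℕ.≤ rank y
    rank-cover : ∀ {x y} → x ⋖ y → rank y ≡ suc (rank x)

  rankL : ℕ
  rankL = rank top

IsSemimodular : FinLattice → Set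
IsSemimodular L = ∀ x y → (x ∧ y) ⋖ x → (x ∧ y) ⋖ y → (x ⋖ (x ∨ y)) × (y ⋖ (x ∨ y))
  where open FinLattice L

IsGeometric : FinLattice → Set
IsGeometric L = FinLattice.IsAtomic L × IsSemimodular L

image : ∀ {m n} → (Fin m → Fin n) → Subset m → Subset n
image f [] = Sub.⊥
image f (b ∷ S) = (if b then ⁅ f zero ⁆ else Sub.⊥) ∪ image (f ∘ suc) S

-- A bijection A(L) → A(P), given as a map on carriers whose restriction
-- to atoms is a bijection onto the atoms (values off atoms are irrelevant)

record AtomBijection (L P : FinLattice) (f' : FinLattice.Elt L → FinLattice.Elt P) : Set where
  module L = FinLattice L
  module P = FinLattice P
  field
    maps-atoms : ∀ {a} → L.IsAtom a → P.IsAtom (f' a)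
    injective  : ∀ {a b} → L.IsAtom a → L.IsAtom b → f' a ≡ f' b → a ≡ b
    surjective : ∀ {p} → P.IsAtom p → Σ L.Elt λ a → L.IsAtom a × (f' a ≡ p)

IsRankPreservingEmbeddingExtending :
  (L P : FinLattice) (gL : IsGraded L) (gP : IsGraded P)
  (f' : FinLattice.Elt L → FinLattice.Elt P) (f : FinLattice.Elt L → FinLattice.Elt P) → Set
IsRankPreservingEmbeddingExtending L P gL gP f' f =
  (∀ {a} → L.IsAtom a → f a ≡ f' a) ×
  (∀ x y → (x L.≤ y → f x P.≤ f y) × (f x P.≤ f y → x L.≤ y)) ×
  (∀ x → IsGraded.rank gP (f x) ≡ IsGraded.rank gL x)
  where
    module L = FinLattice L
    module P = FinLattice P

{-# OPTIONS --safe #-}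
-- In a geometric lattice every NBB set S is independent, rank (⋁ S) = ∣ S ∣: its ω-least atom is not
-- below the join of the others (they would form a BB set), so by semimodularity adding it raises the
-- rank by exactly one.
--
-- Given the embedding f, an NBB set stays NBB for the order transported along f′, since a bounding
-- atom pulls back through f; and a set A with rank (⋁ A) < ∣ A ∣ cannot map into I(P), because
-- rank (⋁ f′(A)) ≤ rank (f (⋁ A)) = rank (⋁ A).
--
-- Conversely put f x = ⋁ f′(atoms below x). Following a maximal chain up to x writes x as the join of
-- an irredundant list of rank x atoms, which is NBB for the order by position in the list; by (i) the
-- join of its image has rank rank x, so rank (f x) ≥ rank x, and adjoining an atom below x but not below y shows
-- that f reflects the order. If rank (f x) > rank x, then rank (f x) independent atoms among
-- f′(atoms below x) pull back to a set A with rank (⋁ A) < ∣ A ∣ whose image is in I(P), against (ii).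
module Submission where

open import Defs
open import Data.Nat as ℕ using (ℕ; zero; suc)
import Data.Nat.Properties as ℕ
open import Data.Fin using (Fin; zero; suc; toℕ; _≟_)
open import Data.Fin.Properties using (toℕ-injective; suc-injective; any?)
open import Data.Fin.Subset as Subset
  using (Subset; _∈_; _∉_; _⊆_; Nonempty; ⁅_⁆; _∪_; _∩_; _-_; ∣_∣; inside; outside; _⊂_)
open import Data.Fin.Subset.Properties
open import Data.Fin.Subset.Induction using (⊂-wellFounded)
open import Data.Vec using ([]; _∷_; here; there; tabulate)
open import Data.Vec.Properties using (lookup∘tabulate; []=⇒lookup; lookup⇒[]=)
open import Data.List using (List; []; _∷_; length; allFin)
open import Data.List.Membership.Propositional.Properties using (∈-allFin)
open import Data.List.Membership.Propositional using () renaming (_∈_ to _∈ˡ_)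
open import Data.List.Relation.Unary.Any using (here; there)
open import Data.Product using (Σ; _×_; ∃; _,_; proj₁; proj₂)
open import Data.Sum using (_⊎_; inj₁; inj₂)
open import Data.Empty using (⊥; ⊥-elim)
open import Data.Unit using (⊤; tt)
open import Induction.WellFounded using (Acc; acc)
open import Relation.Binary.Definitions using (tri<; tri≈; tri>)
open import Relation.Nullary using (¬_; Dec; yes; no; does)
open import Relation.Nullary.Decidable using (_×-dec_; ¬?; dec-true)
open import Relation.Unary using (Decidable)
open import Relation.Binary.PropositionalEquality
  using (_≡_; _≢_; refl; sym; trans; cong; subst; subst₂; module ≡-Reasoning)
open import Function using (_∘_; id)
import Relation.Binary.Lattice.Structures as LS
open import Function.Bundles using (_⇔_; mk⇔)

private
  variable
    m n : ℕ

satisfying : {P : Fin n → Set} → Decidable P → Subset n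
satisfying P? = tabulate (does ∘ P?)

module _ {P : Fin n → Set} (P? : Decidable P) where

  ∈-satisfying⁺ : ∀ {x} → P x → x ∈ satisfying P?
  ∈-satisfying⁺ {x} px = lookup⇒[]= x _ (trans (lookup∘tabulate _ x) (dec-true (P? x) px))

  ∈-satisfying⁻ : ∀ {x} → x ∈ satisfying P? → P x
  ∈-satisfying⁻ {x} x∈ with P? x | trans (sym (lookup∘tabulate (does ∘ P?) x)) ([]=⇒lookup x∈)
  ... | yes px | _ = px
  ... | no _   | ()

preimage : (Fin m → Fin n) → Subset n → Subset m
preimage f D = satisfying (λ x → f x ∈? D)

module _ {f : Fin m → Fin n} {D : Subset n} {x : Fin m} where

  ∈-preimage⁺ : f x ∈ D → x ∈ preimage f D
  ∈-preimage⁺ = ∈-satisfying⁺ (λ x → f x ∈? D)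

  ∈-preimage⁻ : x ∈ preimage f D → f x ∈ D
  ∈-preimage⁻ = ∈-satisfying⁻ (λ x → f x ∈? D)

x∉p-x : ∀ (p : Subset n) x → x ∉ p - x
x∉p-x (_ ∷ p) (suc x) (there x∈) = x∉p-x p x x∈

x∈p-y⇒x∈p∧x≢y : ∀ {p : Subset n} {x y} → x ∈ p - y → x ∈ p × x ≢ y
x∈p-y⇒x∈p∧x≢y {p = p} {x} x∈ = p─q⊆p p _ x∈ , λ { refl → x∉p-x p x x∈ }

x∈p⇒∣p∣≡1+∣p-x∣ : ∀ {p : Subset n} {x} → x ∈ p → ∣ p ∣ ≡ suc ∣ p - x ∣
x∈p⇒∣p∣≡1+∣p-x∣ {p = inside ∷ p} here = cong suc (cong ∣_∣ (sym (p─⊥≡p p)))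
x∈p⇒∣p∣≡1+∣p-x∣ {p = inside ∷ p} (there x∈) = cong suc (x∈p⇒∣p∣≡1+∣p-x∣ x∈)
x∈p⇒∣p∣≡1+∣p-x∣ {p = outside ∷ p} (there x∈) = x∈p⇒∣p∣≡1+∣p-x∣ x∈

x∉p⇒∣⁅x⁆∪p∣≡1+∣p∣ : ∀ {p : Subset n} {x} → x ∉ p → ∣ ⁅ x ⁆ ∪ p ∣ ≡ suc ∣ p ∣
x∉p⇒∣⁅x⁆∪p∣≡1+∣p∣ {p = inside ∷ p} {zero} x∉ = ⊥-elim (x∉ here)
x∉p⇒∣⁅x⁆∪p∣≡1+∣p∣ {p = outside ∷ p} {zero} x∉ = cong suc (cong ∣_∣ (∪-identityˡ p))
x∉p⇒∣⁅x⁆∪p∣≡1+∣p∣ {p = inside ∷ p} {suc x} x∉ = cong suc (x∉p⇒∣⁅x⁆∪p∣≡1+∣p∣ (x∉ ∘ there))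
x∉p⇒∣⁅x⁆∪p∣≡1+∣p∣ {p = outside ∷ p} {suc x} x∉ = x∉p⇒∣⁅x⁆∪p∣≡1+∣p∣ (x∉ ∘ there)

InjectiveOn : (Fin m → Fin n) → Subset m → Set
InjectiveOn f S = ∀ {x y} → x ∈ S → y ∈ S → f x ≡ f y → x ≡ y

image-∈⁺ : ∀ (f : Fin m → Fin n) {S x} → x ∈ S → f x ∈ image f S
image-∈⁺ f {inside ∷ _} here = x∈p∪q⁺ (inj₁ (x∈⁅x⁆ (f zero)))
image-∈⁺ f {_ ∷ _} (there x∈) = x∈p∪q⁺ (inj₂ (image-∈⁺ (f ∘ suc) x∈))

image-∈⁻ : ∀ (f : Fin m → Fin n) S {y} → y ∈ image f S → ∃ λ x → x ∈ S × f x ≡ y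
image-∈⁻ f [] y∈ = ⊥-elim (∉⊥ y∈)
image-∈⁻ f (inside ∷ S) y∈ with x∈p∪q⁻ ⁅ f zero ⁆ (image (f ∘ suc) S) y∈
... | inj₁ y∈⁅f0⁆ = zero , here , sym (x∈⁅y⁆⇒x≡y _ y∈⁅f0⁆)
... | inj₂ y∈img = let x , x∈ , fx≡y = image-∈⁻ (f ∘ suc) S y∈img in suc x , there x∈ , fx≡y
image-∈⁻ f (outside ∷ S) y∈ with x∈p∪q⁻ Subset.⊥ (image (f ∘ suc) S) y∈
... | inj₁ y∈⊥ = ⊥-elim (∉⊥ y∈⊥)
... | inj₂ y∈img = let x , x∈ , fx≡y = image-∈⁻ (f ∘ suc) S y∈img in suc x , there x∈ , fx≡y

InjectiveOn-tail : ∀ {f : Fin (suc m) → Fin n} {s S} → InjectiveOn f (s ∷ S) → InjectiveOn (f ∘ suc) S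
InjectiveOn-tail inj x∈ y∈ eq = suc-injective (inj (there x∈) (there y∈) eq)

∣image∣≡∣S∣ : ∀ (f : Fin m → Fin n) S → InjectiveOn f S → ∣ image f S ∣ ≡ ∣ S ∣
∣image∣≡∣S∣ {n = n} f [] _ = ∣⊥∣≡0 n
∣image∣≡∣S∣ f (inside ∷ S) inj =
  trans (x∉p⇒∣⁅x⁆∪p∣≡1+∣p∣ f0∉) (cong suc (∣image∣≡∣S∣ (f ∘ suc) S (InjectiveOn-tail inj)))
  where
  f0∉ : f zero ∉ image (f ∘ suc) S
  f0∉ f0∈ with image-∈⁻ (f ∘ suc) S f0∈
  ... | x , x∈ , eq with () ← inj (there x∈) here eq
∣image∣≡∣S∣ f (outside ∷ S) inj =
  trans (cong ∣_∣ (∪-identityˡ (image (f ∘ suc) S))) (∣image∣≡∣S∣ (f ∘ suc) S (InjectiveOn-tail inj))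

image-preimage : ∀ (f : Fin m → Fin n) {S : Subset m} {D : Subset n} →
                 D ⊆ image f S → image f (S ∩ preimage f D) ≡ D
image-preimage f {S} {D} D⊆ = ⊆-antisym image⊆D D⊆image
  where
  image⊆D : image f (S ∩ preimage f D) ⊆ D
  image⊆D y∈ with image-∈⁻ f (S ∩ preimage f D) y∈
  ... | x , x∈ , refl = ∈-preimage⁻ {f = f} (proj₂ (x∈p∩q⁻ S _ x∈))
  D⊆image : D ⊆ image f (S ∩ preimage f D)
  D⊆image y∈ with image-∈⁻ f S (D⊆ y∈)
  ... | x , x∈ , refl = image-∈⁺ f (x∈p∩q⁺ (x∈ , ∈-preimage⁺ {f = f} y∈))

-- Ties in the key are broken by the index, which makes the order total.
_≺⟨_⟩_ : Fin n → (Fin n → ℕ) → Fin n → Set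
a ≺⟨ key ⟩ b = key a ℕ.< key b ⊎ (key a ≡ key b × toℕ a ℕ.< toℕ b)

module _ (key : Fin n → ℕ) where

  ≺⟨⟩-irrefl : ∀ {a} → ¬ a ≺⟨ key ⟩ a
  ≺⟨⟩-irrefl (inj₁ p) = ℕ.<-irrefl refl p
  ≺⟨⟩-irrefl (inj₂ (_ , p)) = ℕ.<-irrefl refl p

  ≺⟨⟩-trans : ∀ {a b c} → a ≺⟨ key ⟩ b → b ≺⟨ key ⟩ c → a ≺⟨ key ⟩ c
  ≺⟨⟩-trans (inj₁ p) (inj₁ q) = inj₁ (ℕ.<-trans p q)
  ≺⟨⟩-trans {a} (inj₁ p) (inj₂ (e , _)) = inj₁ (subst (key a ℕ.<_) e p)
  ≺⟨⟩-trans {c = c} (inj₂ (e , _)) (inj₁ q) = inj₁ (subst (ℕ._< key c) (sym e) q)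
  ≺⟨⟩-trans (inj₂ (e , p)) (inj₂ (e′ , q)) = inj₂ (trans e e′ , ℕ.<-trans p q)

  ≺⟨⟩-total : ∀ {a b} → a ≢ b → a ≺⟨ key ⟩ b ⊎ b ≺⟨ key ⟩ a
  ≺⟨⟩-total {a} {b} a≢b with ℕ.<-cmp (key a) (key b)
  ... | tri< p _ _ = inj₁ (inj₁ p)
  ... | tri> _ _ p = inj₂ (inj₁ p)
  ... | tri≈ _ e _ with ℕ.<-cmp (toℕ a) (toℕ b)
  ...   | tri< p _ _ = inj₁ (inj₂ (e , p))
  ...   | tri> _ _ p = inj₂ (inj₂ (sym e , p))
  ...   | tri≈ _ e′ _ = ⊥-elim (a≢b (toℕ-injective e′))

module Lattice (L : FinLattice) where
  open FinLattice L public
  open LS.IsBoundedLattice isBoundedLattice public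
    using (antisym; reflexive; x≤x∨y; y≤x∨y; ∨-least; x∧y≤x; x∧y≤y; ∧-greatest)
    renaming (refl to ≤-refl; trans to ≤-trans; minimum to bot≤)

  _<?_ : ∀ x y → Dec (x < y)
  x <? y = (x ≤? y) ×-dec ¬? (x ≟ y)

  ≤-<-trans : ∀ {x y z} → x ≤ y → y < z → x < z
  ≤-<-trans x≤y (y≤z , y≢z) = ≤-trans x≤y y≤z , λ { refl → y≢z (antisym y≤z x≤y) }

  bot∨x≡x : ∀ x → (bot ∨ x) ≡ x
  bot∨x≡x x = antisym (∨-least (bot≤ x) ≤-refl) (y≤x∨y bot x)

  joinAux-ub : ∀ {m} (g : Fin m → Elt) S {x} → x ∈ S → g x ≤ joinAux g S
  joinAux-ub g (inside ∷ S) here = x≤x∨y _ _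
  joinAux-ub g (inside ∷ S) (there x∈) = ≤-trans (joinAux-ub (g ∘ suc) S x∈) (y≤x∨y _ _)
  joinAux-ub g (outside ∷ S) (there x∈) = joinAux-ub (g ∘ suc) S x∈

  joinAux-lub : ∀ {m} (g : Fin m → Elt) S {u} → (∀ {x} → x ∈ S → g x ≤ u) → joinAux g S ≤ u
  joinAux-lub g [] _ = bot≤ _
  joinAux-lub g (inside ∷ S) h = ∨-least (h here) (joinAux-lub (g ∘ suc) S (h ∘ there))
  joinAux-lub g (outside ∷ S) h = joinAux-lub (g ∘ suc) S (h ∘ there)

  ⋁-ub : ∀ {S x} → x ∈ S → x ≤ ⋁ S
  ⋁-ub {S} = joinAux-ub id S

  ⋁-lub : ∀ {S u} → (∀ {x} → x ∈ S → x ≤ u) → ⋁ S ≤ u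
  ⋁-lub {S} = joinAux-lub id S

  ⋁-image-lub : ∀ {m} (g : Fin m → Elt) S {u} → (∀ {t} → t ∈ S → g t ≤ u) → ⋁ (image g S) ≤ u
  ⋁-image-lub g S h = ⋁-lub λ y∈ → let t , t∈ , gt≡y = image-∈⁻ g S y∈ in subst (_≤ _) gt≡y (h t∈)

  ⋁-≰ : ∀ {S u} → ¬ ⋁ S ≤ u → ∃ λ t → t ∈ S × ¬ t ≤ u
  ⋁-≰ {S} {u} ⋁S≰u with any? (λ t → (t ∈? S) ×-dec ¬? (t ≤? u))
  ... | yes (t , t∈ , t≰u) = t , t∈ , t≰u
  ... | no none = ⊥-elim (⋁S≰u (⋁-lub below))
    where
    below : ∀ {t} → t ∈ S → t ≤ u
    below {t} t∈ with t ≤? u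
    ... | yes t≤u = t≤u
    ... | no t≰u = ⊥-elim (none (t , t∈ , t≰u))

  cover-split : ∀ {x y t} → x ⋖ y → x ≤ t → t ≤ y → t ≡ x ⊎ t ≡ y
  cover-split {t = t} (_ , nothing-between) x≤t t≤y with t ≟ _ | t ≟ _
  ... | yes t≡x | _ = inj₁ t≡x
  ... | no _ | yes t≡y = inj₂ t≡y
  ... | no t≢x | no t≢y = ⊥-elim (nothing-between (t , (x≤t , t≢x ∘ sym) , (t≤y , t≢y)))

  private
    maximal-in : {Q : Elt → Set} → Decidable Q → ∀ ts {c} → Q c →
                 ∃ λ w → Q w × c ≤ w × (∀ {t} → t ∈ˡ ts → Q t → ¬ w < t)
    maximal-in Q? [] qc = _ , qc , ≤-refl , λ ()
    maximal-in Q? (t ∷ ts) {c} qc with Q? t ×-dec (c <? t)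
    ... | yes (qt , c<t) =
      let w , qw , t≤w , maximal = maximal-in Q? ts qt in
      w , qw , ≤-trans (proj₁ c<t) t≤w ,
      λ { (here refl) _ (w≤t , w≢t) → w≢t (antisym w≤t t≤w) ; (there t∈) → maximal t∈ }
    ... | no ¬qt×c<t =
      let w , qw , c≤w , maximal = maximal-in Q? ts qc in
      w , qw , c≤w ,
      λ { (here refl) qt w<t → ¬qt×c<t (qt , ≤-<-trans c≤w w<t) ; (there t∈) → maximal t∈ }

  cocover-exists : ∀ {x y} → x < y → ∃ λ w → x ≤ w × w ⋖ y
  cocover-exists {x} {y} x<y
    with maximal-in (λ t → (x ≤? t) ×-dec (t <? y)) (allFin size) (≤-refl , x<y)
  ... | w , (x≤w , w<y) , _ , maximal =
    w , x≤w , w<y , λ (z , w<z , z<y) → maximal (∈-allFin z) (≤-trans x≤w (proj₁ w<z) , z<y) w<z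

  IsAtom? : ∀ a → Dec (IsAtom a)
  IsAtom? a = (bot <? a) ×-dec ¬? (any? λ z → (bot <? z) ×-dec (z <? a))

  atom≢bot : ∀ {a} → IsAtom a → a ≢ bot
  atom≢bot ((_ , bot≢a) , _) a≡bot = bot≢a (sym a≡bot)

  atom-≤-atom : ∀ {a t} → IsAtom a → IsAtom t → t ≤ a → t ≡ a
  atom-≤-atom a-atom t-atom t≤a with cover-split a-atom (bot≤ _) t≤a
  ... | inj₁ t≡bot = ⊥-elim (atom≢bot t-atom t≡bot)
  ... | inj₂ t≡a = t≡a

  atom-witness : IsAtomic → ∀ {x y} → ¬ x ≤ y → ∃ λ c → IsAtom c × c ≤ x × ¬ c ≤ y
  atom-witness atomic {x} x≰y with atomic x
  ... | S , atoms , ⋁S≡x with ⋁-≰ {S} (x≰y ∘ subst (_≤ _) ⋁S≡x)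
  ... | c , c∈ , c≰y = c , atoms c∈ , subst (c ≤_) ⋁S≡x (⋁-ub c∈) , c≰y

  <⇒≱ : ∀ {x y} → x < y → ¬ y ≤ x
  <⇒≱ (x≤y , x≢y) y≤x = x≢y (antisym x≤y y≤x)

  cover-by-atom : ∀ {w x b} → w ⋖ x → b ≤ x → ¬ b ≤ w → (w ∨ b) ≡ x
  cover-by-atom {w} {b = b} w⋖x b≤x b≰w with cover-split w⋖x (x≤x∨y w b) (∨-least (proj₁ (proj₁ w⋖x)) b≤x)
  ... | inj₁ w∨b≡w = ⊥-elim (b≰w (subst (b ≤_) w∨b≡w (y≤x∨y w b)))
  ... | inj₂ w∨b≡x = w∨b≡x

  ⋁-empty : ∀ {S} → ¬ Nonempty S → ⋁ S ≡ bot
  ⋁-empty S-empty = antisym (⋁-lub λ x∈ → ⊥-elim (S-empty (_ , x∈))) (bot≤ _)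

  ⋁-remove : ∀ {S x} → x ∈ S → ⋁ S ≡ (⋁ (S - x) ∨ x)
  ⋁-remove {S} {x} x∈ = antisym (⋁-lub below) (∨-least ⋁S-x≤⋁S (⋁-ub x∈))
    where
    ⋁S-x≤⋁S : ⋁ (S - x) ≤ ⋁ S
    ⋁S-x≤⋁S = ⋁-lub {S - x} (⋁-ub {S} ∘ proj₁ ∘ x∈p-y⇒x∈p∧x≢y {p = S})
    below : ∀ {y} → y ∈ S → y ≤ (⋁ (S - x) ∨ x)
    below {y} y∈ with y ≟ x
    ... | yes refl = y≤x∨y _ _
    ... | no y≢x = ≤-trans (⋁-ub (x∈p∧x≢y⇒x∈p-y y∈ y≢x)) (x≤x∨y _ _)

  NBB-⊆ : ∀ {ω S T} → T ⊆ S → NBB ω S → NBB ω T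
  NBB-⊆ T⊆S (atoms , no-BB) = atoms ∘ T⊆S , λ D D⊆T → no-BB D (T⊆S ∘ D⊆T)

  module _ (ω : LinearOrderOnAtoms) where
    open LinearOrderOnAtoms ω using (_≺_; total) renaming (trans to ≺-trans)

    ω-minimum : ∀ S → AtomSet S → Nonempty S → ∃ λ m → m ∈ S × (∀ {d} → d ∈ S → d ≢ m → m ≺ d)
    ω-minimum S atoms = minimum S atoms (⊂-wellFounded S)
      where
      minimum : ∀ S → AtomSet S → Acc _⊂_ S → Nonempty S →
                ∃ λ m → m ∈ S × (∀ {d} → d ∈ S → d ≢ m → m ≺ d)
      minimum S atoms (acc smaller) (x , x∈) with nonempty? (S - x)
      ... | no S-x-empty = x , x∈ , λ d∈ d≢x → ⊥-elim (S-x-empty (_ , x∈p∧x≢y⇒x∈p-y d∈ d≢x))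
      ... | yes S-x-nonempty
        with minimum (S - x) (atoms ∘ proj₁ ∘ x∈p-y⇒x∈p∧x≢y) (smaller (x∈p⇒p-x⊂p x∈)) S-x-nonempty
      ... | m , m∈S-x , m-min with x∈p-y⇒x∈p∧x≢y m∈S-x
      ... | m∈S , m≢x with total (atoms x∈) (atoms m∈S) (m≢x ∘ sym)
      ...   | inj₁ x≺m = x , x∈ , x-min
        where
        x-min : ∀ {d} → d ∈ S → d ≢ x → x ≺ d
        x-min {d} d∈ d≢x with d ≟ m
        ... | yes refl = x≺m
        ... | no d≢m = ≺-trans (atoms x∈) (atoms m∈S) (atoms d∈) x≺m (m-min (x∈p∧x≢y⇒x∈p-y d∈ d≢x) d≢m)
      ...   | inj₂ m≺x = m , m∈S , m-min′
        where
        m-min′ : ∀ {d} → d ∈ S → d ≢ m → m ≺ d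
        m-min′ {d} d∈ d≢m with d ≟ x
        ... | yes refl = m≺x
        ... | no d≢x = m-min (x∈p∧x≢y⇒x∈p-y d∈ d≢x) d≢m

  ⋁ˡ : List Elt → Elt
  ⋁ˡ [] = bot
  ⋁ˡ (b ∷ l) = ⋁ˡ l ∨ b

  Irredundant : List Elt → Set
  Irredundant [] = ⊤
  Irredundant (b ∷ l) = IsAtom b × ¬ b ≤ ⋁ˡ l × Irredundant l

  fromList : List Elt → Subset size
  fromList [] = Subset.⊥
  fromList (b ∷ l) = ⁅ b ⁆ ∪ fromList l

  ∈-fromList⁺ : ∀ {a l} → a ∈ˡ l → a ∈ fromList l
  ∈-fromList⁺ {l = b ∷ _} (here refl) = x∈p∪q⁺ (inj₁ (x∈⁅x⁆ b))
  ∈-fromList⁺ (there a∈) = x∈p∪q⁺ (inj₂ (∈-fromList⁺ a∈))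

  ∈-fromList⁻ : ∀ {a} l → a ∈ fromList l → a ∈ˡ l
  ∈-fromList⁻ [] a∈ = ⊥-elim (∉⊥ a∈)
  ∈-fromList⁻ (b ∷ l) a∈ with x∈p∪q⁻ ⁅ b ⁆ (fromList l) a∈
  ... | inj₁ a∈⁅b⁆ = here (x∈⁅y⁆⇒x≡y b a∈⁅b⁆)
  ... | inj₂ a∈l = there (∈-fromList⁻ l a∈l)

  ∈-fromList-tail : ∀ {a b} l → a ∈ fromList (b ∷ l) → a ≢ b → a ∈ fromList l
  ∈-fromList-tail l a∈ a≢b with ∈-fromList⁻ (_ ∷ l) a∈
  ... | here a≡b = ⊥-elim (a≢b a≡b)
  ... | there a∈l = ∈-fromList⁺ a∈l

  ∈⇒≤⋁ˡ : ∀ {a l} → a ∈ˡ l → a ≤ ⋁ˡ l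
  ∈⇒≤⋁ˡ {l = b ∷ l} (here refl) = y≤x∨y (⋁ˡ l) b
  ∈⇒≤⋁ˡ {l = b ∷ l} (there a∈) = ≤-trans (∈⇒≤⋁ˡ a∈) (x≤x∨y (⋁ˡ l) b)

  Irredundant⇒AtomSet : ∀ l → Irredundant l → AtomSet (fromList l)
  Irredundant⇒AtomSet l irr a∈ = atom (∈-fromList⁻ l a∈) irr
    where
    atom : ∀ {a l} → a ∈ˡ l → Irredundant l → IsAtom a
    atom (here refl) (b-atom , _) = b-atom
    atom (there a∈) (_ , _ , irr) = atom a∈ irr

  ∣fromList∣ : ∀ l → Irredundant l → ∣ fromList l ∣ ≡ length l
  ∣fromList∣ [] _ = ∣⊥∣≡0 size
  ∣fromList∣ (b ∷ l) (_ , b≰⋁l , irr) =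
    trans (x∉p⇒∣⁅x⁆∪p∣≡1+∣p∣ (b≰⋁l ∘ ∈⇒≤⋁ˡ ∘ ∈-fromList⁻ l)) (cong suc (∣fromList∣ l irr))

  position : List Elt → Elt → ℕ
  position [] a = 0
  position (b ∷ l) a with a ≟ b
  ... | yes _ = 0
  ... | no _ = suc (position l a)

  _≺[_]_ : Elt → List Elt → Elt → Set
  a ≺[ l ] b = a ≺⟨ position l ⟩ b

  listOrder : List Elt → LinearOrderOnAtoms
  listOrder l = record
    { _≺_ = _≺[ l ]_
    ; irrefl = λ _ → ≺⟨⟩-irrefl (position l)
    ; trans = λ _ _ _ → ≺⟨⟩-trans (position l)
    ; total = λ _ _ → ≺⟨⟩-total (position l)
    }

  position-head : ∀ b l → position (b ∷ l) b ≡ 0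
  position-head b l with b ≟ b
  ... | yes _ = refl
  ... | no b≢b = ⊥-elim (b≢b refl)

  position-tail : ∀ {a b} l → a ≢ b → position (b ∷ l) a ≡ suc (position l a)
  position-tail {a} {b} l a≢b with a ≟ b
  ... | yes a≡b = ⊥-elim (a≢b a≡b)
  ... | no _ = refl

  ≺[]-head : ∀ {a b} l → a ≢ b → ¬ a ≺[ b ∷ l ] b
  ≺[]-head {a} {b} l a≢b a≺b rewrite position-head b l | position-tail l a≢b with a≺b
  ... | inj₁ ()
  ... | inj₂ (() , _)

  ≺[]-tail : ∀ {a b d} l → a ≢ b → d ≢ b → a ≺[ b ∷ l ] d → a ≺[ l ] d
  ≺[]-tail l a≢b d≢b a≺d rewrite position-tail l a≢b | position-tail l d≢b with a≺d
  ... | inj₁ (ℕ.s≤s p) = inj₁ p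
  ... | inj₂ (e , p) = inj₂ (ℕ.suc-injective e , p)

  -- All of D comes after a in l, so ⋁ D lies below the join of the part of l after a.
  irredundant-¬BB : ∀ l → Irredundant l → ∀ {a} D → Nonempty D → D ⊆ fromList l →
                    (∀ {d} → d ∈ D → a ≺[ l ] d) → ¬ a ≤ ⋁ D
  irredundant-¬BB [] _ D (d , d∈) D⊆ _ _ = ∉⊥ (D⊆ d∈)
  irredundant-¬BB (b ∷ l) (_ , b≰⋁l , irr) {a} D D-nonempty D⊆ a≺D a≤⋁D = by-cases (a ≟ b)
    where
    D⊆l : (∀ {d} → d ∈ D → d ≢ b) → D ⊆ fromList l
    D⊆l d≢b d∈ = ∈-fromList-tail l (D⊆ d∈) (d≢b d∈)
    by-cases : Dec (a ≡ b) → ⊥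
    by-cases (yes refl) = b≰⋁l (≤-trans a≤⋁D (⋁-lub (∈⇒≤⋁ˡ ∘ ∈-fromList⁻ l ∘ D⊆l d≢b)))
      where
      d≢b : ∀ {d} → d ∈ D → d ≢ b
      d≢b d∈ refl = ≺⟨⟩-irrefl (position (b ∷ l)) (a≺D d∈)
    by-cases (no a≢b) =
      irredundant-¬BB l irr D D-nonempty (D⊆l d≢b) (λ d∈ → ≺[]-tail l a≢b (d≢b d∈) (a≺D d∈)) a≤⋁D
      where
      d≢b : ∀ {d} → d ∈ D → d ≢ b
      d≢b d∈ refl = ≺[]-head l a≢b (a≺D d∈)

  irredundant⇒InI : ∀ l → Irredundant l → InI (fromList l)
  irredundant⇒InI l irr = listOrder l , Irredundant⇒AtomSet l irr ,
    λ { D D⊆ (D-nonempty , _ , a , _ , a≺D , a≤⋁D) → irredundant-¬BB l irr D D-nonempty D⊆ a≺D a≤⋁D }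

module Graded (L : FinLattice) (gL : IsGraded L) where
  open Lattice L
  open IsGraded gL public

  rank≡0⇒≡bot : ∀ {x} → rank x ≡ 0 → x ≡ bot
  rank≡0⇒≡bot {x} r with x ≟ bot
  ... | yes x≡bot = x≡bot
  ... | no x≢bot with cocover-exists (bot≤ x , x≢bot ∘ sym)
  ...   | _ , _ , w⋖x with () ← trans (sym r) (rank-cover w⋖x)

  rank-suc⇒cocover : ∀ {x n} → rank x ≡ suc n → ∃ λ w → w ⋖ x × rank w ≡ n
  rank-suc⇒cocover {x} r with cocover-exists (bot≤ x , bot≢x)
    where
    bot≢x : bot ≢ x
    bot≢x bot≡x = ℕ.0≢1+n (trans (sym rank-bot) (trans (cong rank bot≡x) r))
  ... | w , _ , w⋖x = w , w⋖x , ℕ.suc-injective (trans (sym (rank-cover w⋖x)) r)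

  irredundant-basis : IsAtomic → ∀ x → ∃ λ l → Irredundant l × ⋁ˡ l ≡ x × length l ≡ rank x
  irredundant-basis atomic x = build (rank x) refl
    where
    build : ∀ n {x} → rank x ≡ n → ∃ λ l → Irredundant l × ⋁ˡ l ≡ x × length l ≡ n
    build zero r = [] , tt , sym (rank≡0⇒≡bot r) , refl
    build (suc n) r with rank-suc⇒cocover r
    ... | w , w⋖x , rank-w with build n rank-w
    ... | l , irr , refl , length-l with atom-witness atomic (<⇒≱ (proj₁ w⋖x))
    ... | b , b-atom , b≤x , b≰w =
      b ∷ l , (b-atom , b≰w , irr) , cover-by-atom w⋖x b≤x b≰w , cong suc length-l

module Semimodular (P : FinLattice) (gP : IsGraded P) (semimodular : IsSemimodular P) where
  open Lattice P
  open Graded P gP public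

  join-atom-covers : ∀ {z m} → IsAtom m → ¬ m ≤ z → z ⋖ (z ∨ m)
  join-atom-covers {z} {m} m-atom = go (rank z) refl
    where
    go : ∀ n {z} → rank z ≡ n → ¬ m ≤ z → z ⋖ (z ∨ m)
    go zero r _ rewrite rank≡0⇒≡bot r = subst (bot ⋖_) (sym (bot∨x≡x m)) m-atom
    go (suc n) {z} r m≰z with rank-suc⇒cocover r
    ... | w , w⋖z , rank-w = subst (z ⋖_) z∨v≡z∨m (proj₁ (semimodular z v z∧v⋖z z∧v⋖v))
      where
      v = w ∨ m
      w≤z = proj₁ (proj₁ w⋖z)
      w⋖v : w ⋖ v
      w⋖v = go n rank-w (m≰z ∘ λ m≤w → ≤-trans m≤w w≤z)
      z∧v≡w : (z ∧ v) ≡ w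
      z∧v≡w with cover-split w⋖z (∧-greatest w≤z (x≤x∨y w m)) (x∧y≤x z v)
      ... | inj₁ z∧v≡w = z∧v≡w
      ... | inj₂ z∧v≡z with cover-split w⋖v w≤z (subst (_≤ v) z∧v≡z (x∧y≤y z v))
      ...   | inj₁ z≡w = ⊥-elim (proj₂ (proj₁ w⋖z) (sym z≡w))
      ...   | inj₂ z≡v = ⊥-elim (m≰z (subst (m ≤_) (sym z≡v) (y≤x∨y w m)))
      z∧v⋖z : (z ∧ v) ⋖ z
      z∧v⋖z = subst (_⋖ z) (sym z∧v≡w) w⋖z
      z∧v⋖v : (z ∧ v) ⋖ v
      z∧v⋖v = subst (_⋖ v) (sym z∧v≡w) w⋖v
      z∨v≡z∨m : (z ∨ v) ≡ (z ∨ m)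
      z∨v≡z∨m = antisym (∨-least (x≤x∨y z m) (∨-least (≤-trans w≤z (x≤x∨y z m)) (y≤x∨y z m)))
                        (∨-least (x≤x∨y z v) (≤-trans (y≤x∨y w m) (y≤x∨y z v)))

  rank-join-atom : ∀ {z m} → IsAtom m → ¬ m ≤ z → rank (z ∨ m) ≡ suc (rank z)
  rank-join-atom m-atom m≰z = rank-cover (join-atom-covers m-atom m≰z)

  rank-⋁ˡ : ∀ l → Irredundant l → rank (⋁ˡ l) ≡ length l
  rank-⋁ˡ [] _ = rank-bot
  rank-⋁ˡ (b ∷ l) (b-atom , b≰⋁l , irr) = trans (rank-join-atom b-atom b≰⋁l) (cong suc (rank-⋁ˡ l irr))

  rank-⋁-NBB : ∀ ω S → NBB ω S → rank (⋁ S) ≡ ∣ S ∣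
  rank-⋁-NBB ω S = go S (⊂-wellFounded S)
    where
    open LinearOrderOnAtoms ω using (_≺_)
    open ≡-Reasoning
    go : ∀ S → Acc _⊂_ S → NBB ω S → rank (⋁ S) ≡ ∣ S ∣
    go S _ _ with nonempty? S
    go S _ _ | no S-empty = begin
      rank (⋁ S)  ≡⟨ cong rank (⋁-empty S-empty) ⟩
      rank bot    ≡⟨ rank-bot ⟩
      0           ≡⟨ sym (∣⊥∣≡0 size) ⟩
      ∣ Subset.⊥ {n = size} ∣ ≡⟨ cong ∣_∣ (sym (Empty-unique S-empty)) ⟩
      ∣ S ∣       ∎
    go S (acc smaller) nbb@(atoms , no-BB) | yes S-nonempty = begin
      rank (⋁ S)              ≡⟨ cong rank (⋁-remove a∈) ⟩
      rank (⋁ (S - a) ∨ a)    ≡⟨ rank-join-atom (atoms a∈) a≰⋁S-a ⟩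
      suc (rank (⋁ (S - a)))  ≡⟨ cong suc (go (S - a) (smaller (x∈p⇒p-x⊂p a∈)) S-a-NBB) ⟩
      suc ∣ S - a ∣           ≡⟨ sym (x∈p⇒∣p∣≡1+∣p-x∣ a∈) ⟩
      ∣ S ∣                   ∎
      where
      minimum = ω-minimum ω S atoms S-nonempty
      a = proj₁ minimum
      a∈ = proj₁ (proj₂ minimum)
      S-a-NBB : NBB ω (S - a)
      S-a-NBB = NBB-⊆ {ω} (p─q⊆p S ⁅ a ⁆) nbb
      a≺S-a : ∀ {d} → d ∈ S - a → a ≺ d
      a≺S-a d∈ = let d∈S , d≢a = x∈p-y⇒x∈p∧x≢y d∈ in proj₂ (proj₂ minimum) d∈S d≢a
      a≰⋁S-a : ¬ a ≤ ⋁ (S - a)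
      a≰⋁S-a a≤ with nonempty? (S - a)
      ... | yes S-a-nonempty =
        no-BB (S - a) (p─q⊆p S ⁅ a ⁆) (S-a-nonempty , atoms ∘ p─q⊆p S ⁅ a ⁆ , a , atoms a∈ , a≺S-a , a≤)
      ... | no S-a-empty = atom≢bot (atoms a∈) (antisym (subst (a ≤_) (⋁-empty S-a-empty) a≤) (bot≤ a))

  rank-⋁-InI : ∀ {S} → InI S → rank (⋁ S) ≡ ∣ S ∣
  rank-⋁-InI {S} (ω , nbb) = rank-⋁-NBB ω S nbb

  irredundant-within : ∀ {T} → AtomSet T → ∀ k → k ℕ.≤ rank (⋁ T) →
                       ∃ λ l → Irredundant l × length l ≡ k × (∀ {a} → a ∈ˡ l → a ∈ T)
  irredundant-within _ zero _ = [] , tt , refl , λ ()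
  irredundant-within {T} atoms (suc k) k<rank with irredundant-within atoms k (ℕ.<⇒≤ k<rank)
  ... | l , irr , length-l , l⊆T with ⋁-≰ {T} ⋁T≰⋁l
    where
    ⋁T≰⋁l : ¬ ⋁ T ≤ ⋁ˡ l
    ⋁T≰⋁l ⋁T≤ = ℕ.<⇒≱ k<rank (subst (rank (⋁ T) ℕ.≤_) (trans (rank-⋁ˡ l irr) length-l) (rank-mono ⋁T≤))
  ... | t , t∈ , t≰⋁l = t ∷ l , (atoms t∈ , t≰⋁l , irr) , cong suc length-l ,
                        λ { (here refl) → t∈ ; (there a∈) → l⊆T a∈ }

module Extension (L P : FinLattice) (gL : IsGraded L) (gP : IsGraded P) (semimodular : IsSemimodular P)
                 (f′ : FinLattice.Elt L → FinLattice.Elt P) (bij : AtomBijection L P f′) where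
  module L = Lattice L
  module P = Lattice P
  module GL = Graded L gL
  module GP = Semimodular P gP semimodular
  open AtomBijection bij using (maps-atoms; injective; surjective)

  ∣image-f′∣ : ∀ {S} → L.AtomSet S → ∣ image f′ S ∣ ≡ ∣ S ∣
  ∣image-f′∣ {S} atoms = ∣image∣≡∣S∣ f′ S λ x∈ y∈ → injective (atoms x∈) (atoms y∈)

  image-f′-atoms : ∀ {S} → L.AtomSet S → P.AtomSet (image f′ S)
  image-f′-atoms {S} atoms p∈ with image-∈⁻ f′ S p∈
  ... | a , a∈ , refl = maps-atoms (atoms a∈)

  module Transport (ω : L.LinearOrderOnAtoms) where
    open L.LinearOrderOnAtoms ω using (_≺_) renaming (irrefl to ≺-irrefl; trans to ≺-trans; total to ≺-total)

    _≺′_ : P.Elt → P.Elt → Set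
    p ≺′ q = ∃ λ a → ∃ λ b → L.IsAtom a × L.IsAtom b × f′ a ≡ p × f′ b ≡ q × a ≺ b

    ≺′⇒≺ : ∀ {a b} → L.IsAtom a → L.IsAtom b → f′ a ≺′ f′ b → a ≺ b
    ≺′⇒≺ a-atom b-atom (a₁ , b₁ , a₁-atom , b₁-atom , fa₁≡fa , fb₁≡fb , a₁≺b₁) =
      subst₂ _≺_ (injective a₁-atom a-atom fa₁≡fa) (injective b₁-atom b-atom fb₁≡fb) a₁≺b₁

    order : P.LinearOrderOnAtoms
    order = record
      { _≺_ = _≺′_
      ; irrefl = λ { _ r@(a , _ , a-atom , _ , refl , _) → ≺-irrefl a-atom (≺′⇒≺ a-atom a-atom r) }
      ; trans = λ { _ _ _ r@(a , b , a-atom , b-atom , refl , refl , _)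
                          s@(_ , c , _ , c-atom , _ , refl , _) →
                    a , c , a-atom , c-atom , refl , refl ,
                    ≺-trans a-atom b-atom c-atom (≺′⇒≺ a-atom b-atom r) (≺′⇒≺ b-atom c-atom s) }
      ; total = total
      }
      where
      total : ∀ {p q} → P.IsAtom p → P.IsAtom q → p ≢ q → p ≺′ q ⊎ q ≺′ p
      total p-atom q-atom p≢q with surjective p-atom | surjective q-atom
      ... | a , a-atom , refl | b , b-atom , refl with ≺-total a-atom b-atom (p≢q ∘ cong f′)
      ...   | inj₁ a≺b = inj₁ (a , b , a-atom , b-atom , refl , refl , a≺b)
      ...   | inj₂ b≺a = inj₂ (b , a , b-atom , a-atom , refl , refl , b≺a)

  module Forward (f : L.Elt → P.Elt) (embedding : IsRankPreservingEmbeddingExtending L P gL gP f′ f) where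
    extends : ∀ {a} → L.IsAtom a → f a ≡ f′ a
    extends = proj₁ embedding

    preserves-rank : ∀ x → GP.rank (f x) ≡ GL.rank x
    preserves-rank = proj₂ (proj₂ embedding)

    monotone : ∀ {x y} → x L.≤ y → f x P.≤ f y
    monotone = proj₁ (proj₁ (proj₂ embedding) _ _)

    reflects : ∀ {x y} → f x P.≤ f y → x L.≤ y
    reflects = proj₂ (proj₁ (proj₂ embedding) _ _)

    ⋁-image-≤ : ∀ {S} → L.AtomSet S → P.⋁ (image f′ S) P.≤ f (L.⋁ S)
    ⋁-image-≤ {S} atoms = P.⋁-image-lub f′ S λ t∈ → subst (P._≤ _) (extends (atoms t∈)) (monotone (L.⋁-ub t∈))

    preserves-InI : ∀ I → L.InI I → P.InI (image f′ I)
    preserves-InI I (ω , I-atoms , no-BB) = Transport.order ω , image-f′-atoms I-atoms , no-BBᴾ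
      where
      open L.LinearOrderOnAtoms ω using (_≺_)
      no-BBᴾ : ∀ D → D ⊆ image f′ I → ¬ P.BB (Transport.order ω) D
      no-BBᴾ D D⊆ ((d , d∈) , _ , p , p-atom , p≺D , p≤⋁D) with surjective p-atom
      ... | a , a-atom , refl = no-BB D′ D′⊆I (D′-nonempty , I-atoms ∘ D′⊆I , a , a-atom , a≺D′ , a≤⋁D′)
        where
        D′ = I ∩ preimage f′ D
        D′⊆I : D′ ⊆ I
        D′⊆I = p∩q⊆p I _
        D′-nonempty : Nonempty D′
        D′-nonempty with image-∈⁻ f′ I (D⊆ d∈)
        ... | t , t∈ , refl = t , x∈p∩q⁺ (t∈ , ∈-preimage⁺ {f = f′} d∈)
        a≺D′ : ∀ {t} → t ∈ D′ → a ≺ t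
        a≺D′ t∈ = let t∈I , ft∈D = x∈p∩q⁻ I _ t∈ in
          Transport.≺′⇒≺ ω a-atom (I-atoms t∈I) (p≺D (∈-preimage⁻ {f = f′} ft∈D))
        ⋁D≤f⋁D′ : P.⋁ D P.≤ f (L.⋁ D′)
        ⋁D≤f⋁D′ = subst (λ E → P.⋁ E P.≤ f (L.⋁ D′)) (image-preimage f′ {S = I} D⊆)
                        (⋁-image-≤ (I-atoms ∘ D′⊆I))
        a≤⋁D′ : a L.≤ L.⋁ D′
        a≤⋁D′ = reflects (P.≤-trans (P.reflexive (extends a-atom)) (P.≤-trans p≤⋁D ⋁D≤f⋁D′))

    dependent-not-InI : ∀ A → L.AtomSet A → GL.rank (L.⋁ A) ℕ.< ∣ A ∣ → ¬ P.InI (image f′ A)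
    dependent-not-InI A atoms rank<∣A∣ inI = ℕ.<⇒≱ rank<∣A∣ (begin
      ∣ A ∣                         ≡⟨ sym (∣image-f′∣ atoms) ⟩
      ∣ image f′ A ∣                ≡⟨ sym (GP.rank-⋁-InI inI) ⟩
      GP.rank (P.⋁ (image f′ A))    ≤⟨ GP.rank-mono (⋁-image-≤ atoms) ⟩
      GP.rank (f (L.⋁ A))           ≡⟨ preserves-rank (L.⋁ A) ⟩
      GL.rank (L.⋁ A)               ∎)
      where open ℕ.≤-Reasoning

  module Backward (atomic : L.IsAtomic)
                  (preserves-InI : ∀ I → L.InI I → P.InI (image f′ I))
                  (dependent-not-InI : ∀ A → L.AtomSet A → GL.rank (L.⋁ A) ℕ.< ∣ A ∣ → ¬ P.InI (image f′ A))
                  where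

    atomsBelow : L.Elt → Subset L.size
    atomsBelow x = satisfying λ t → L.IsAtom? t ×-dec (t L.≤? x)

    ∈-atomsBelow⁺ : ∀ {t x} → L.IsAtom t → t L.≤ x → t ∈ atomsBelow x
    ∈-atomsBelow⁺ {x = x} t-atom t≤x = ∈-satisfying⁺ (λ t → L.IsAtom? t ×-dec (t L.≤? x)) (t-atom , t≤x)

    ∈-atomsBelow⁻ : ∀ {t x} → t ∈ atomsBelow x → L.IsAtom t × t L.≤ x
    ∈-atomsBelow⁻ {x = x} = ∈-satisfying⁻ (λ t → L.IsAtom? t ×-dec (t L.≤? x))

    f : L.Elt → P.Elt
    f x = P.⋁ (image f′ (atomsBelow x))

    f′≤f : ∀ {t x} → L.IsAtom t → t L.≤ x → f′ t P.≤ f x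
    f′≤f t-atom t≤x = P.⋁-ub (image-∈⁺ f′ (∈-atomsBelow⁺ t-atom t≤x))

    f-lub : ∀ {x u} → (∀ {t} → L.IsAtom t → t L.≤ x → f′ t P.≤ u) → f x P.≤ u
    f-lub {x} h = P.⋁-image-lub f′ (atomsBelow x) λ t∈ → let t-atom , t≤x = ∈-atomsBelow⁻ t∈ in h t-atom t≤x

    f-extends : ∀ {a} → L.IsAtom a → f a ≡ f′ a
    f-extends a-atom = P.antisym
      (f-lub λ t-atom t≤a → P.reflexive (cong f′ (L.atom-≤-atom a-atom t-atom t≤a)))
      (f′≤f a-atom L.≤-refl)

    f-monotone : ∀ {x y} → x L.≤ y → f x P.≤ f y
    f-monotone x≤y = f-lub λ t-atom t≤x → f′≤f t-atom (L.≤-trans t≤x x≤y)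

    rank-⋁-image : ∀ l → L.Irredundant l → GP.rank (P.⋁ (image f′ (L.fromList l))) ≡ length l
    rank-⋁-image l irr = begin
      GP.rank (P.⋁ (image f′ (L.fromList l)))  ≡⟨ GP.rank-⋁-InI (preserves-InI _ (L.irredundant⇒InI l irr)) ⟩
      ∣ image f′ (L.fromList l) ∣              ≡⟨ ∣image-f′∣ (L.Irredundant⇒AtomSet l irr) ⟩
      ∣ L.fromList l ∣                         ≡⟨ L.∣fromList∣ l irr ⟩
      length l                                 ∎
      where open ≡-Reasoning

    rank≤rank-f : ∀ x → GL.rank x ℕ.≤ GP.rank (f x)
    rank≤rank-f x with GL.irredundant-basis atomic x
    ... | l , irr , refl , length-l = begin
      GL.rank (L.⋁ˡ l)                          ≡⟨ sym length-l ⟩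
      length l                                 ≡⟨ sym (rank-⋁-image l irr) ⟩
      GP.rank (P.⋁ (image f′ (L.fromList l)))  ≤⟨ GP.rank-mono (P.⋁-image-lub f′ _ below) ⟩
      GP.rank (f (L.⋁ˡ l))                      ∎
      where
      open ℕ.≤-Reasoning
      below : ∀ {t} → t ∈ L.fromList l → f′ t P.≤ f (L.⋁ˡ l)
      below t∈ = f′≤f (L.Irredundant⇒AtomSet l irr t∈) (L.∈⇒≤⋁ˡ (L.∈-fromList⁻ l t∈))

    image-atomsBelow-atoms : ∀ x → P.AtomSet (image f′ (atomsBelow x))
    image-atomsBelow-atoms x = image-f′-atoms (proj₁ ∘ ∈-atomsBelow⁻)

    rank-f≤rank : ∀ x → GP.rank (f x) ℕ.≤ GL.rank x
    rank-f≤rank x with GP.irredundant-within (image-atomsBelow-atoms x) (GP.rank (f x)) ℕ.≤-refl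
    ... | l , irr , length-l , l⊆image = ℕ.≮⇒≥ λ rank<rank-f →
      dependent-not-InI A A-atoms (rank-⋁A<∣A∣ rank<rank-f)
        (subst P.InI (sym image-f′-A) (P.irredundant⇒InI l irr))
      where
      A = atomsBelow x ∩ preimage f′ (P.fromList l)
      A⊆atomsBelow : A ⊆ atomsBelow x
      A⊆atomsBelow = p∩q⊆p (atomsBelow x) _
      A-atoms : L.AtomSet A
      A-atoms = proj₁ ∘ ∈-atomsBelow⁻ ∘ A⊆atomsBelow
      image-f′-A : image f′ A ≡ P.fromList l
      image-f′-A = image-preimage f′ {S = atomsBelow x} (l⊆image ∘ P.∈-fromList⁻ l)
      rank-⋁A<∣A∣ : GL.rank x ℕ.< GP.rank (f x) → GL.rank (L.⋁ A) ℕ.< ∣ A ∣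
      rank-⋁A<∣A∣ rank<rank-f = begin-strict
        GL.rank (L.⋁ A)     ≤⟨ GL.rank-mono (L.⋁-lub (proj₂ ∘ ∈-atomsBelow⁻ ∘ A⊆atomsBelow)) ⟩
        GL.rank x           <⟨ rank<rank-f ⟩
        GP.rank (f x)       ≡⟨ sym length-l ⟩
        length l            ≡⟨ sym (P.∣fromList∣ l irr) ⟩
        ∣ P.fromList l ∣    ≡⟨ cong ∣_∣ (sym image-f′-A) ⟩
        ∣ image f′ A ∣      ≡⟨ ∣image-f′∣ A-atoms ⟩
        ∣ A ∣               ∎
        where open ℕ.≤-Reasoning

    f-preserves-rank : ∀ x → GP.rank (f x) ≡ GL.rank x
    f-preserves-rank x = ℕ.≤-antisym (rank-f≤rank x) (rank≤rank-f x)

    f-reflects : ∀ {x y} → f x P.≤ f y → x L.≤ y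
    f-reflects {x} {y} fx≤fy with x L.≤? y
    ... | yes x≤y = x≤y
    ... | no x≰y with L.atom-witness atomic x≰y | GL.irredundant-basis atomic y
    ...   | c , c-atom , c≤x , c≰y | l , irr , refl , length-l = ⊥-elim (ℕ.1+n≰n (begin
      suc (GL.rank (L.⋁ˡ l))                         ≡⟨ cong suc (sym length-l) ⟩
      length (c ∷ l)                                ≡⟨ sym (rank-⋁-image (c ∷ l) irr′) ⟩
      GP.rank (P.⋁ (image f′ (L.fromList (c ∷ l))))  ≤⟨ GP.rank-mono (P.⋁-image-lub f′ _ below) ⟩
      GP.rank (f (L.⋁ˡ l))                           ≡⟨ f-preserves-rank (L.⋁ˡ l) ⟩
      GL.rank (L.⋁ˡ l)                               ∎))
      where
      open ℕ.≤-Reasoning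
      irr′ : L.Irredundant (c ∷ l)
      irr′ = c-atom , c≰y , irr
      below : ∀ {t} → t ∈ L.fromList (c ∷ l) → f′ t P.≤ f (L.⋁ˡ l)
      below t∈ with L.∈-fromList⁻ (c ∷ l) t∈
      ... | here refl = P.≤-trans (f′≤f c-atom c≤x) fx≤fy
      ... | there t∈l = f′≤f (L.Irredundant⇒AtomSet l irr (L.∈-fromList⁺ t∈l)) (L.∈⇒≤⋁ˡ t∈l)

    embedding : IsRankPreservingEmbeddingExtending L P gL gP f′ f
    embedding = f-extends , (λ _ _ → f-monotone , f-reflects) , f-preserves-rank

-- Imported only here: unqualified, it would clash with the lattice order _<_ above.
open import Data.Nat using (_<_)

theorem3p7 : (L P : FinLattice) (gL : IsGraded L) (gP : IsGraded P) →
  FinLattice.IsAtomic L → IsGeometric P →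
  IsGraded.rankL gP ≡ IsGraded.rankL gL →
  (f' : FinLattice.Elt L → FinLattice.Elt P) → AtomBijection L P f' →
  (Σ (FinLattice.Elt L → FinLattice.Elt P) λ f → IsRankPreservingEmbeddingExtending L P gL gP f' f)
  ⇔
  ((∀ (I : Subset (FinLattice.size L)) → FinLattice.InI L I → FinLattice.InI P (image f' I))
   ×
   (∀ (A : Subset (FinLattice.size L)) → FinLattice.AtomSet L A →
      IsGraded.rank gL (FinLattice.⋁ L A) < ∣ A ∣ →
      ¬ FinLattice.InI P (image f' A)))
theorem3p7 L P gL gP atomic (_ , semimodular) _ f′ bij = mk⇔
  (λ (f , is-embedding) → let open Forward f is-embedding in preserves-InI , dependent-not-InI)
  (λ (preserves-InI , dependent-not-InI) →
     let open Backward atomic preserves-InI dependent-not-InI in f , embedding)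
  where open Extension L P gL gP semimodular f′ bij
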